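{- Let $n\ge 1$, let ${\bf x}=(x_1,\dots,x_n)$ with $\overline{x}_i=x_i^{ -1}$, let ${\bf a}=(a_1,a_2,\ldots)$ be arbitrary, and let $\lambda=(\lambda_1,\dots,\lambda_n)$ be a partition of length $\ell(\lambda)\le n$. Then, with all determinants $n\times n$ with $(i,j)$ entry as displayed, $$gl_\lambda({\bf x}|{\bf a})=\frac{\left|\, h^{gl}_{\lambda_j+n-j}(x_i|{\bf a})\,\right|}{\left|\, h^{gl}_{n-j}(x_i|{\bf a})\,\right|},\qquad sp_\lambda({\bf x},\overline{{\bf x}}|{\bf a})=\frac{\left|\, h^{sp}_{\lambda_j+n-j}(x_i,\overline{x}_i|{\bf a})\,\right|}{\left|\, h^{sp}_{n-j}(x_i,\overline{x}_i|{\bf a})\,\right|},$$ $$so_\lambda({\bf x},\overline{{\bf x}},1|{\bf a})=\frac{\left|\, h^{oo}_{\lambda_j+n-j}(x_i,\overline{x}_i,1|{\bf a})\,\right|}{\left|\, h^{oo}_{n-j}(x_i,\overline{x}_i,1|{\bf a})\,\right|},\qquad o_\lambda({\bf x},\overline{{\bf x}}|{\bf a})=\frac{\left|\, h^{eo}_{\lambda_j+n-j}(x_i,\overline{x}_i|{\bf a})\,\right|}{\left|\, h^{eo}_{n-j}(x_i,\overline{x}_i|{\bf a})\,\right|}.$$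
   Context: For an indeterminate $y$ and integer $m\ge0$, the factorial power is $(y|{\bf a})^m=(y+a_1)(y+a_2)\cdots(y+a_m)$ for $m>0$ and $(y|{\bf a})^0=1$. For a power series $F(t)$, $[t^m]F(t)$ denotes the coefficient of $t^m$. The factorial characters are defined (determinants $n\times n$, $(i,j)$ entry shown): $gl_\lambda({\bf x}|{\bf a})=\left|(x_i|{\bf a})^{\lambda_j+n-j}\right|/\left|(x_i|{\bf a})^{n-j}\right|$; $sp_\lambda({\bf x},\overline{{\bf x}}|{\bf a})=\left|x_i(x_i|{\bf a})^{\lambda_j+n-j}-\overline{x}_i(\overline{x}_i|{\bf a})^{\lambda_j+n-j}\right|/\left|x_i(x_i|{\bf a})^{n-j}-\overline{x}_i(\overline{x}_i|{\bf a})^{n-j}\right|$; $so_\lambda({\bf x},\overline{{\bf x}},1|{\bf a})=\left|x_i^{1/2}(x_i|{\bf a})^{\lambda_j+n-j}-\overline{x}_i^{1/2}(\overline{x}_i|{\bf a})^{\lambda_j+n-j}\right|/\left|x_i^{1/2}(x_i|{\bf a})^{n-j}-\overline{x}_i^{1/2}(\overline{x}_i|{\bf a})^{n-j}\right|$; $o_\lambda({\bf x},\overline{{\bf x}}|{\bf a})=\eta\left|(x_i|{\bf a})^{\lambda_j+n-j}+(\overline{x}_i|{\bf a})^{\lambda_j+n-j}\right|/\big(\tfrac12\left|(x_i|{\bf a})^{n-j}+(\overline{x}_i|{\bf a})^{n-j}\right|\big)$, where $\eta=\tfrac12$ if $\lambda_n=0$ and $\eta=1$ if $\lambda_n>0$.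 For a single variable $y$ with $\overline{y}=y^{ -1}$ and integer $m\ge 0$ define $h^{gl}_m(y|{\bf a})=[t^m]\,\frac{1}{1-ty}\prod_{j=1}^{m}(1+ta_j)$, $h^{sp}_m(y,\overline{y}|{\bf a})=[t^m]\,\frac{1}{(1-ty)(1-t\overline{y})}\prod_{j=1}^{m}(1+ta_j)$, $h^{oo}_m(y,\overline{y},1|{\bf a})=[t^m]\,\frac{1+t}{(1-ty)(1-t\overline{y})}\prod_{j=1}^{m}(1+ta_j)$, $h^{eo}_m(y,\overline{y}|{\bf a})=[t^m]\,\Big(\frac{1}{1-ty}+\frac{1}{1-t\overline{y}}-\delta_{m0}\Big)\prod_{j=1}^{m}(1+ta_j)$, where $\delta_{m0}=1$ if $m=0$ and $0$ otherwise; all of these equal $0$ for $m<0$. -}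

module Defs where

open import Level using (Level)
open import Data.Nat as ℕ using (ℕ; zero; suc; _∸_)
open import Data.Fin as Fin using (Fin; zero; suc; toℕ; punchIn)
open import Algebra.Bundles using (CommutativeRing)

module Char {c ℓ : Level} (R : CommutativeRing c ℓ) where

  open CommutativeRing R using (Carrier; _+_; _*_; -_; _-_; 0#; 1#)

  infixr 8 _^_
  _^_ : Carrier → ℕ → Carrier
  y ^ zero  = 1#
  y ^ suc k = y * (y ^ k)

  sumUpTo : (ℕ → Carrier) → ℕ → Carrier
  sumUpTo f zero    = f zero
  sumUpTo f (suc m) = sumUpTo f m + f (suc m)

  sumFin : (n : ℕ) → (Fin n → Carrier) → Carrier
  sumFin zero    f = 0#
  sumFin (suc n) f = f zero + sumFin n (λ i → f (suc i))

  Matrix : ℕ → Set c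
  Matrix n = Fin n → Fin n → Carrier

  sign : ℕ → Carrier
  sign zero    = 1#
  sign (suc k) = - sign k

  det : (n : ℕ) → Matrix n → Carrier
  det zero    M = 1#
  det (suc n) M =
    sumFin (suc n) (λ i → sign (toℕ i) * (M i zero *
      det n (λ r s → M (punchIn i r) (suc s))))

  -- Factorial power (y|a)^m = (y+a_1)...(y+a_m); the sequence a = (a_1,a_2,...)
  -- is given as a function ℕ → Carrier with a_k = a k (a 0 is unused).
  fpow : Carrier → (ℕ → Carrier) → ℕ → Carrier
  fpow y a zero    = 1#
  fpow y a (suc m) = fpow y a m * (y + a (suc m))

  -- Formal power series in t, as coefficient sequences
  Series : Set c
  Series = ℕ → Carrier

  _⊕_ : Series → Series → Series
  (f ⊕ g) m = f m + g m

  _⊖_ : Series → Series → Series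
  (f ⊖ g) m = f m - g m

  _⊛_ : Series → Series → Series
  (f ⊛ g) m = sumUpTo (λ k → f k * g (m ∸ k)) m

  oneS : Series
  oneS zero    = 1#
  oneS (suc _) = 0#

  zeroS : Series
  zeroS _ = 0#

  lin : Carrier → Series
  lin c zero          = 1#
  lin c (suc zero)    = c
  lin c (suc (suc _)) = 0#

  -- 1/(1 - t y) = Σ y^k t^k
  geom : Carrier → Series
  geom y k = y ^ k

  prodLin : (ℕ → Carrier) → ℕ → Series
  prodLin a zero    = oneS
  prodLin a (suc m) = prodLin a m ⊛ lin (a (suc m))

  deltaS : ℕ → Series
  deltaS zero    = oneS
  deltaS (suc _) = zeroS

  -- The h-functions  ([t^m] F(t)  =  F m)
  hgl : ℕ → Carrier → (ℕ → Carrier) → Carrier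
  hgl m y a = (geom y ⊛ prodLin a m) m

  hsp : ℕ → Carrier → Carrier → (ℕ → Carrier) → Carrier
  hsp m y yb a = ((geom y ⊛ geom yb) ⊛ prodLin a m) m

  hoo : ℕ → Carrier → Carrier → (ℕ → Carrier) → Carrier
  hoo m y yb a = ((lin 1# ⊛ (geom y ⊛ geom yb)) ⊛ prodLin a m) m

  heo : ℕ → Carrier → Carrier → (ℕ → Carrier) → Carrier
  heo m y yb a = (((geom y ⊕ geom yb) ⊖ deltaS m) ⊛ prodLin a m) m

  -- Exponents λ_j + n - j (j 1-indexed), i.e. for 0-indexed j : Fin n
  -- the exponent is λ j + (n - (toℕ j + 1)).
  expo : (n : ℕ) → (Fin n → ℕ) → Fin n → ℕ
  expo n lam j = lam j ℕ.+ (n ∸ suc (toℕ j))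

  expo0 : (n : ℕ) → Fin n → ℕ
  expo0 n j = n ∸ suc (toℕ j)

  IsPartition : (n : ℕ) → (Fin n → ℕ) → Set
  IsPartition n lam = ∀ (i j : Fin n) → i Fin.≤ j → lam j ℕ.≤ lam i

  -- Numerator / denominator determinants of the factorial characters.
  -- e : Fin n → ℕ is the column exponent (expo n λ for numerators,
  -- expo0 n for denominators).
  glDet : (n : ℕ) → (Fin n → ℕ) → (Fin n → Carrier) → (ℕ → Carrier) → Carrier
  glDet n e x a = det n (λ i j → fpow (x i) a (e j))

  spDet : (n : ℕ) → (Fin n → ℕ) → (Fin n → Carrier) → (Fin n → Carrier) →
          (ℕ → Carrier) → Carrier
  spDet n e x xb a =
    det n (λ i j → x i * fpow (x i) a (e j) - xb i * fpow (xb i) a (e j))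

  -- sx i plays x_i^{1/2}, sxb i plays \bar x_i^{1/2}
  soDet : (n : ℕ) → (Fin n → ℕ) → (Fin n → Carrier) → (Fin n → Carrier) →
          (Fin n → Carrier) → (Fin n → Carrier) → (ℕ → Carrier) → Carrier
  soDet n e x xb sx sxb a =
    det n (λ i j → sx i * fpow (x i) a (e j) - sxb i * fpow (xb i) a (e j))

  oDet : (n : ℕ) → (Fin n → ℕ) → (Fin n → Carrier) → (Fin n → Carrier) →
         (ℕ → Carrier) → Carrier
  oDet n e x xb a = det n (λ i j → fpow (x i) a (e j) + fpow (xb i) a (e j))

  -- η = 1/2 if λ_n = 0, and 1 if λ_n > 0   (half is a given inverse of 2)
  eta : Carrier → ℕ → Carrier
  eta half zero    = half
  eta half (suc _) = 1#

  hglDet : (n : ℕ) → (Fin n → ℕ) → (Fin n → Carrier) → (ℕ → Carrier) → Carrier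
  hglDet n e x a = det n (λ i j → hgl (e j) (x i) a)

  hspDet : (n : ℕ) → (Fin n → ℕ) → (Fin n → Carrier) → (Fin n → Carrier) →
           (ℕ → Carrier) → Carrier
  hspDet n e x xb a = det n (λ i j → hsp (e j) (x i) (xb i) a)

  hooDet : (n : ℕ) → (Fin n → ℕ) → (Fin n → Carrier) → (Fin n → Carrier) →
           (ℕ → Carrier) → Carrier
  hooDet n e x xb a = det n (λ i j → hoo (e j) (x i) (xb i) a)

  heoDet : (n : ℕ) → (Fin n → ℕ) → (Fin n → Carrier) → (Fin n → Carrier) →
           (ℕ → Carrier) → Carrier
  heoDet n e x xb a = det n (λ i j → heo (e j) (x i) (xb i) a)

-- All four identities are entrywise statements about single h-functions.
-- The t^m coefficient of (1/(1-ty)) ∏_{j≤m} (1 + t a_j) is (y|a)^m, because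
-- multiplying by 1 + t a_{m+1} turns the diagonal coefficient (y|a)^m into
-- (y|a)^m (y + a_{m+1}) while ∏_{j≤m} (1 + t a_j) has degree m.  Next,
--   (y - ȳ) / ((1-ty)(1-tȳ)) = y/(1-ty) - ȳ/(1-tȳ),
--   (x^{1/2} - x̄^{1/2}) (1+t) / ((1-tx)(1-tx̄)) = x^{1/2}/(1-tx) - x̄^{1/2}/(1-tx̄)
-- (the latter using x^{1/2} x̄^{1/2} = 1), so (y - ȳ) h^sp_m = y (y|a)^m - ȳ (ȳ|a)^m
-- and (x^{1/2} - x̄^{1/2}) h^oo_m = x^{1/2} (x|a)^m - x̄^{1/2} (x̄|a)^m.  Finally
-- h^eo_m = (y|a)^m + (ȳ|a)^m for m > 0 and h^eo_0 = 1.  Hence each h-determinant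
-- is the corresponding character determinant with its rows (for h^eo: its
-- columns, the factor 1/2 at the column of exponent 0) rescaled by factors that
-- do not depend on λ, and these cancel in the ratios.  Nothing here uses that λ
-- is a partition: the identities hold for arbitrary exponent vectors.
module Submission where

open import Defs
open import Level using (Level)
open import Data.Nat using (ℕ; suc)
open import Data.Fin using (Fin; fromℕ)
open import Data.Product using (_×_; _,_)
open import Algebra.Bundles using (CommutativeRing)
import Data.Nat.Properties as ℕ
import Relation.Binary.PropositionalEquality as ≡

module _ {c ℓ : Level} (R : CommutativeRing c ℓ) where
  open Data.Nat using (zero; _∸_; _≤_; _<_; z≤n; s≤s)
  open Data.Fin using (zero; suc; toℕ; punchIn)
  open CommutativeRing R hiding (zero)
  open Char R
  open import Algebra.Properties.Ring ring using (-0#≈0#; [y-z]x≈yx-zx)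
  open import Algebra.Properties.AbelianGroup +-abelianGroup using (xyx⁻¹≈y)
  open import Algebra.Solver.Ring.NaturalCoefficients.Default commutativeSemiring
  open import Relation.Binary.Reasoning.Setoid setoid

  a+d≈c+b⇒a-b≈c-d : ∀ a b c d → a + d ≈ c + b → a - b ≈ c - d
  a+d≈c+b⇒a-b≈c-d a b c d a+d≈c+b = begin
    a - b                 ≈⟨ xyx⁻¹≈y d (a - b) ⟨
    d + (a - b) - d       ≈⟨ +-congʳ (solve 3 (λ a nb d → d :+ (a :+ nb) := (a :+ d) :+ nb) refl a (- b) d) ⟩
    (a + d) - b - d       ≈⟨ +-congʳ (+-congʳ a+d≈c+b) ⟩
    (c + b) - b - d       ≈⟨ +-congʳ (trans (+-congʳ (+-comm c b)) (xyx⁻¹≈y b c)) ⟩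
    c - d                 ∎

  cross-multiply : ∀ {A B C D} p → A ≈ p * C → B ≈ p * D → A * D ≈ B * C
  cross-multiply {A} {B} {C} {D} p A≈pC B≈pD = begin
    A * D        ≈⟨ *-congʳ A≈pC ⟩
    (p * C) * D  ≈⟨ solve 3 (λ p C D → (p :* C) :* D := (p :* D) :* C) refl p C D ⟩
    (p * D) * C  ≈⟨ *-congʳ B≈pD ⟨
    B * C        ∎

  sumUpTo-cong : ∀ {f g : ℕ → Carrier} n → (∀ k → f k ≈ g k) → sumUpTo f n ≈ sumUpTo g n
  sumUpTo-cong zero    f≈g = f≈g zero
  sumUpTo-cong (suc n) f≈g = +-cong (sumUpTo-cong n f≈g) (f≈g (suc n))

  sumUpTo-unfoldˡ : ∀ (f : ℕ → Carrier) n → sumUpTo f (suc n) ≈ f zero + sumUpTo (λ k → f (suc k)) n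
  sumUpTo-unfoldˡ f zero    = refl
  sumUpTo-unfoldˡ f (suc n) = trans (+-congʳ (sumUpTo-unfoldˡ f n)) (+-assoc _ _ _)

  sumUpTo-zero : ∀ (f : ℕ → Carrier) n → (∀ k → k ≤ n → f k ≈ 0#) → sumUpTo f n ≈ 0#
  sumUpTo-zero f zero    f≈0 = f≈0 zero z≤n
  sumUpTo-zero f (suc n) f≈0 = begin
    sumUpTo f n + f (suc n) ≈⟨ +-cong (sumUpTo-zero f n (λ k k≤n → f≈0 k (ℕ.m≤n⇒m≤1+n k≤n))) (f≈0 (suc n) ℕ.≤-refl) ⟩
    0# + 0#                 ≈⟨ +-identityˡ 0# ⟩
    0#                      ∎

  sumUpTo-*ˡ : ∀ u (f : ℕ → Carrier) n → sumUpTo (λ k → u * f k) n ≈ u * sumUpTo f n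
  sumUpTo-*ˡ u f zero    = refl
  sumUpTo-*ˡ u f (suc n) = trans (+-congʳ (sumUpTo-*ˡ u f n)) (sym (distribˡ u _ _))

  sumUpTo-+ : ∀ (f g : ℕ → Carrier) n → sumUpTo (λ k → f k + g k) n ≈ sumUpTo f n + sumUpTo g n
  sumUpTo-+ f g zero    = refl
  sumUpTo-+ f g (suc n) = trans (+-congʳ (sumUpTo-+ f g n))
    (solve 4 (λ a b c d → (a :+ b) :+ (c :+ d) := (a :+ c) :+ (b :+ d)) refl _ _ _ _)

  ⊛-congˡ : ∀ {F G : Series} (P : Series) n → (∀ k → F k ≈ G k) → (F ⊛ P) n ≈ (G ⊛ P) n
  ⊛-congˡ P n F≈G = sumUpTo-cong n (λ k → *-congʳ (F≈G k))

  ⊛-distribʳ-⊕ : ∀ (F G P : Series) n → ((F ⊕ G) ⊛ P) n ≈ (F ⊛ P) n + (G ⊛ P) n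
  ⊛-distribʳ-⊕ F G P n = trans (sumUpTo-cong n (λ k → distribʳ _ _ _)) (sumUpTo-+ _ _ n)

  ⊛-*ˡ : ∀ u (F P : Series) n → ((λ k → u * F k) ⊛ P) n ≈ u * (F ⊛ P) n
  ⊛-*ˡ u F P n = trans (sumUpTo-cong n (λ k → *-assoc _ _ _)) (sumUpTo-*ˡ u _ n)

  ⊛-relation : ∀ (S T U V P : Series) α β γ δ → (∀ k → α * S k + β * T k ≈ γ * U k + δ * V k) →
    ∀ n → α * (S ⊛ P) n + β * (T ⊛ P) n ≈ γ * (U ⊛ P) n + δ * (V ⊛ P) n
  ⊛-relation S T U V P α β γ δ rel n = begin
    α * (S ⊛ P) n + β * (T ⊛ P) n                          ≈⟨ combination α S β T ⟨
    (((λ k → α * S k) ⊕ (λ k → β * T k)) ⊛ P) n  ≈⟨ ⊛-congˡ P n rel ⟩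
    (((λ k → γ * U k) ⊕ (λ k → δ * V k)) ⊛ P) n  ≈⟨ combination γ U δ V ⟩
    γ * (U ⊛ P) n + δ * (V ⊛ P) n                          ∎
    where
    combination : ∀ α S β T → (((λ k → α * S k) ⊕ (λ k → β * T k)) ⊛ P) n ≈ α * (S ⊛ P) n + β * (T ⊛ P) n
    combination α S β T = trans (⊛-distribʳ-⊕ _ _ P n) (+-cong (⊛-*ˡ α S P n) (⊛-*ˡ β T P n))

  geom-⊛-suc : ∀ y (Q : Series) n → (geom y ⊛ Q) (suc n) ≈ Q (suc n) + y * (geom y ⊛ Q) n
  geom-⊛-suc y Q n = begin
    (geom y ⊛ Q) (suc n)                                       ≈⟨ sumUpTo-unfoldˡ (λ k → y ^ k * Q (suc n ∸ k)) n ⟩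
    1# * Q (suc n) + sumUpTo (λ k → (y * y ^ k) * Q (n ∸ k)) n  ≈⟨ +-cong (*-identityˡ _) (sumUpTo-cong n (λ k → *-assoc _ _ _)) ⟩
    Q (suc n) + sumUpTo (λ k → y * (y ^ k * Q (n ∸ k))) n      ≈⟨ +-congˡ (sumUpTo-*ˡ y _ n) ⟩
    Q (suc n) + y * (geom y ⊛ Q) n                             ∎

  ⊛-lin-suc : ∀ (S : Series) u n → (S ⊛ lin u) (suc n) ≈ S (suc n) + u * S n
  ⊛-lin-suc S u n = begin
    sumUpTo (λ k → S k * lin u (suc n ∸ k)) n + S (suc n) * lin u (n ∸ n)
      ≈⟨ +-cong (lower-terms n) (*-congˡ (reflexive (≡.cong (lin u) (ℕ.n∸n≡0 n)))) ⟩
    S n * u + S (suc n) * 1#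
      ≈⟨ solve 3 (λ s₀ s₁ u → s₀ :* u :+ s₁ :* con 1 := s₁ :+ u :* s₀) refl (S n) (S (suc n)) u ⟩
    S (suc n) + u * S n ∎
    where
    lower-terms : ∀ n → sumUpTo (λ k → S k * lin u (suc n ∸ k)) n ≈ S n * u
    lower-terms zero    = refl
    lower-terms (suc n) = begin
      sumUpTo (λ k → S k * lin u (suc (suc n) ∸ k)) n + S (suc n) * lin u (suc n ∸ n)
        ≈⟨ +-cong (sumUpTo-zero _ n vanish) (*-congˡ (reflexive (≡.cong (lin u) (ℕ.m+n∸n≡m 1 n)))) ⟩
      0# + S (suc n) * u ≈⟨ +-identityˡ _ ⟩
      S (suc n) * u      ∎
      where
      vanish : ∀ k → k ≤ n → S k * lin u (suc (suc n) ∸ k) ≈ 0#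
      vanish k k≤n = trans (*-congˡ (reflexive (≡.cong (lin u) (ℕ.+-∸-assoc 2 k≤n)))) (zeroʳ _)

  lin-⊛-suc : ∀ (S : Series) u n → (lin u ⊛ S) (suc n) ≈ S (suc n) + u * S n
  lin-⊛-suc S u zero    = +-congʳ (*-identityˡ _)
  lin-⊛-suc S u (suc n) = begin
    (lin u ⊛ S) (suc (suc n))
      ≈⟨ sumUpTo-unfoldˡ (λ k → lin u k * S (suc (suc n) ∸ k)) (suc n) ⟩
    1# * S (suc (suc n)) + sumUpTo (λ k → lin u (suc k) * S (suc n ∸ k)) (suc n)
      ≈⟨ +-cong (*-identityˡ _) (sumUpTo-unfoldˡ (λ k → lin u (suc k) * S (suc n ∸ k)) n) ⟩
    S (suc (suc n)) + (u * S (suc n) + sumUpTo (λ k → 0# * S (n ∸ k)) n)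
      ≈⟨ +-congˡ (+-congˡ (sumUpTo-zero _ n (λ k _ → zeroˡ _))) ⟩
    S (suc (suc n)) + (u * S (suc n) + 0#) ≈⟨ +-congˡ (+-identityʳ _) ⟩
    S (suc (suc n)) + u * S (suc n)        ∎

  prodLin-vanishes : ∀ (a : ℕ → Carrier) m n → m < n → prodLin a m n ≈ 0#
  prodLin-vanishes a zero    (suc n) _         = refl
  prodLin-vanishes a (suc m) (suc n) (s≤s m<n) = begin
    prodLin a (suc m) (suc n)                        ≈⟨ ⊛-lin-suc (prodLin a m) (a (suc m)) n ⟩
    prodLin a m (suc n) + a (suc m) * prodLin a m n  ≈⟨ +-cong (prodLin-vanishes a m (suc n) (ℕ.m≤n⇒m≤1+n m<n)) (*-congˡ (prodLin-vanishes a m n m<n)) ⟩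
    0# + a (suc m) * 0#                              ≈⟨ trans (+-identityˡ _) (zeroʳ _) ⟩
    0#                                               ∎

  geom-⊛-⊛-lin : ∀ y (Q : Series) u n →
    (geom y ⊛ (Q ⊛ lin u)) (suc n) ≈ (geom y ⊛ Q) (suc n) + u * (geom y ⊛ Q) n
  geom-⊛-⊛-lin y Q u zero = begin
    (geom y ⊛ (Q ⊛ lin u)) 1              ≈⟨ geom-⊛-suc y (Q ⊛ lin u) 0 ⟩
    (Q ⊛ lin u) 1 + y * (1# * (Q 0 * 1#))  ≈⟨ +-cong (⊛-lin-suc Q u 0) (*-congˡ (*-congˡ (*-identityʳ _))) ⟩
    (Q 1 + u * Q 0) + y * (1# * Q 0)
      ≈⟨ solve 4 (λ q₁ q₀ u y → (q₁ :+ u :* q₀) :+ y :* (con 1 :* q₀) := (q₁ :+ y :* (con 1 :* q₀)) :+ u :* (con 1 :* q₀)) refl (Q 1) (Q 0) u y ⟩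
    (Q 1 + y * (1# * Q 0)) + u * (1# * Q 0) ≈⟨ +-congʳ (geom-⊛-suc y Q 0) ⟨
    (geom y ⊛ Q) 1 + u * (geom y ⊛ Q) 0    ∎
  geom-⊛-⊛-lin y Q u (suc n) = begin
    (geom y ⊛ (Q ⊛ lin u)) (suc (suc n))
      ≈⟨ geom-⊛-suc y (Q ⊛ lin u) (suc n) ⟩
    (Q ⊛ lin u) (suc (suc n)) + y * (geom y ⊛ (Q ⊛ lin u)) (suc n)
      ≈⟨ +-cong (⊛-lin-suc Q u (suc n)) (*-congˡ (geom-⊛-⊛-lin y Q u n)) ⟩
    (Q (suc (suc n)) + u * Q (suc n)) + y * (G (suc n) + u * G n)
      ≈⟨ solve 6 (λ q₂ q₁ u y g₁ g₀ → (q₂ :+ u :* q₁) :+ y :* (g₁ :+ u :* g₀) := (q₂ :+ y :* g₁) :+ u :* (q₁ :+ y :* g₀))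
               refl (Q (suc (suc n))) (Q (suc n)) u y (G (suc n)) (G n) ⟩
    (Q (suc (suc n)) + y * G (suc n)) + u * (Q (suc n) + y * G n)
      ≈⟨ +-cong (geom-⊛-suc y Q (suc n)) (*-congˡ (geom-⊛-suc y Q n)) ⟨
    G (suc (suc n)) + u * G (suc n) ∎
    where
    G = geom y ⊛ Q

  hgl≈fpow : ∀ m y a → hgl m y a ≈ fpow y a m
  hgl≈fpow zero    y a = *-identityˡ _
  hgl≈fpow (suc m) y a = begin
    hgl (suc m) y a                                          ≈⟨ geom-⊛-⊛-lin y P u m ⟩
    (geom y ⊛ P) (suc m) + u * hgl m y a                     ≈⟨ +-congʳ (geom-⊛-suc y P m) ⟩
    (P (suc m) + y * hgl m y a) + u * hgl m y a              ≈⟨ +-cong (+-cong (prodLin-vanishes a m (suc m) ℕ.≤-refl) (*-congˡ (hgl≈fpow m y a))) (*-congˡ (hgl≈fpow m y a)) ⟩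
    (0# + y * fpow y a m) + u * fpow y a m                   ≈⟨ solve 3 (λ y u F → (con 0 :+ y :* F) :+ u :* F := F :* (y :+ u)) refl y u (fpow y a m) ⟩
    fpow y a m * (y + u)                                     ∎
    where
    u = a (suc m)
    P = prodLin a m

  -- A coefficientwise identity u/(1-ty) - ub/(1-t yb) = (u - ub) S(t) of series
  -- turns, after multiplying by ∏_{j≤m} (1 + t a_j), into one of factorial powers.
  fpow-difference : ∀ u ub y yb (S : Series) a m →
    (∀ k → u * geom y k + ub * S k ≈ ub * geom yb k + u * S k) →
    u * fpow y a m - ub * fpow yb a m ≈ (u - ub) * (S ⊛ prodLin a m) m
  fpow-difference u ub y yb S a m rel =
    trans (a+d≈c+b⇒a-b≈c-d _ _ _ _ (trans relation (+-comm _ _))) (sym ([y-z]x≈yx-zx h u ub))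
    where
    h = (S ⊛ prodLin a m) m
    relation : u * fpow y a m + ub * h ≈ ub * fpow yb a m + u * h
    relation = begin
      u * fpow y a m + ub * h    ≈⟨ +-congʳ (*-congˡ (hgl≈fpow m y a)) ⟨
      u * hgl m y a + ub * h     ≈⟨ ⊛-relation (geom y) S (geom yb) S (prodLin a m) u ub ub u rel m ⟩
      ub * hgl m yb a + u * h    ≈⟨ +-congʳ (*-congˡ (hgl≈fpow m yb a)) ⟩
      ub * fpow yb a m + u * h   ∎

  geom-⊛-geom-relation : ∀ y yb k →
    y * geom y k + yb * (geom y ⊛ geom yb) k ≈ yb * geom yb k + y * (geom y ⊛ geom yb) k
  geom-⊛-geom-relation y yb zero =
    solve 2 (λ y yb → y :* con 1 :+ yb :* (con 1 :* con 1) := yb :* con 1 :+ y :* (con 1 :* con 1)) refl y yb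
  geom-⊛-geom-relation y yb (suc k) = begin
    y * (y * Y) + yb * H (suc k)        ≈⟨ +-congˡ (*-congˡ (geom-⊛-suc y (geom yb) k)) ⟩
    y * (y * Y) + yb * (yb * B + y * Hₖ)
      ≈⟨ solve 5 (λ y yb Y B H → y :* (y :* Y) :+ yb :* (yb :* B :+ y :* H) := y :* (y :* Y :+ yb :* H) :+ yb :* (yb :* B)) refl y yb Y B Hₖ ⟩
    y * (y * Y + yb * Hₖ) + yb * (yb * B) ≈⟨ +-congʳ (*-congˡ (geom-⊛-geom-relation y yb k)) ⟩
    y * (yb * B + y * Hₖ) + yb * (yb * B)
      ≈⟨ solve 4 (λ y yb B H → y :* (yb :* B :+ y :* H) :+ yb :* (yb :* B) := yb :* (yb :* B) :+ y :* (yb :* B :+ y :* H)) refl y yb B Hₖ ⟩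
    yb * (yb * B) + y * (yb * B + y * Hₖ) ≈⟨ +-congˡ (*-congˡ (geom-⊛-suc y (geom yb) k)) ⟨
    yb * (yb * B) + y * H (suc k)       ∎
    where
    H = geom y ⊛ geom yb
    Y = y ^ k
    B = yb ^ k
    Hₖ = H k

  sp-entry : ∀ m y yb a → y * fpow y a m - yb * fpow yb a m ≈ (y - yb) * hsp m y yb a
  sp-entry m y yb a = fpow-difference y yb y yb _ a m (geom-⊛-geom-relation y yb)

  oo-series-suc : ∀ x xb n →
    (lin 1# ⊛ (geom x ⊛ geom xb)) (suc n) ≈ xb * xb ^ n + xb ^ n + x * (lin 1# ⊛ (geom x ⊛ geom xb)) n
  oo-series-suc x xb zero = begin
    (lin 1# ⊛ H) 1                                      ≈⟨ lin-⊛-suc H 1# 0 ⟩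
    H 1 + 1# * H 0                                      ≈⟨ +-congʳ (geom-⊛-suc x (geom xb) 0) ⟩
    (xb * 1# + x * (1# * 1#)) + 1# * (1# * 1#)
      ≈⟨ solve 2 (λ x xb → (xb :* con 1 :+ x :* (con 1 :* con 1)) :+ con 1 :* (con 1 :* con 1) := xb :* con 1 :+ con 1 :+ x :* (con 1 :* (con 1 :* con 1))) refl x xb ⟩
    xb * 1# + 1# + x * (lin 1# ⊛ H) 0                  ∎
    where
    H = geom x ⊛ geom xb
  oo-series-suc x xb (suc n) = begin
    (lin 1# ⊛ H) (suc (suc n))         ≈⟨ lin-⊛-suc H 1# (suc n) ⟩
    H (suc (suc n)) + 1# * H (suc n)   ≈⟨ +-cong (geom-⊛-suc x (geom xb) (suc n)) (*-congˡ (geom-⊛-suc x (geom xb) n)) ⟩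
    (xb * B + x * H (suc n)) + 1# * (B + x * H n)
      ≈⟨ solve 5 (λ x xb B H₁ H₀ → (xb :* B :+ x :* H₁) :+ con 1 :* (B :+ x :* H₀) := xb :* B :+ B :+ x :* (H₁ :+ con 1 :* H₀)) refl x xb B (H (suc n)) (H n) ⟩
    xb * B + B + x * (H (suc n) + 1# * H n) ≈⟨ +-congˡ (*-congˡ (lin-⊛-suc H 1# n)) ⟨
    xb * B + B + x * (lin 1# ⊛ H) (suc n)  ∎
    where
    H = geom x ⊛ geom xb
    B = xb ^ suc n

  -- s and sb play x^{1/2} and x̄^{1/2}; only x sb = s and s xb = sb are needed.
  oo-series-relation : ∀ s sb x xb → x * sb ≈ s → s * xb ≈ sb → ∀ k →
    s * geom x k + sb * (lin 1# ⊛ (geom x ⊛ geom xb)) k ≈ sb * geom xb k + s * (lin 1# ⊛ (geom x ⊛ geom xb)) k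
  oo-series-relation s sb x xb xsb≈s sxb≈sb zero =
    solve 2 (λ s sb → s :* con 1 :+ sb :* (con 1 :* (con 1 :* con 1)) := sb :* con 1 :+ s :* (con 1 :* (con 1 :* con 1))) refl s sb
  oo-series-relation s sb x xb xsb≈s sxb≈sb (suc k) = begin
    s * (x * X) + sb * T (suc k)                         ≈⟨ +-congˡ (*-congˡ (oo-series-suc x xb k)) ⟩
    s * (x * X) + sb * (xb * B + B + x * Tₖ)
      ≈⟨ solve 7 (λ s sb x xb X B T → s :* (x :* X) :+ sb :* (xb :* B :+ B :+ x :* T) := x :* (s :* X :+ sb :* T) :+ sb :* (xb :* B) :+ sb :* B) refl s sb x xb X B Tₖ ⟩
    x * (s * X + sb * Tₖ) + sb * (xb * B) + sb * B       ≈⟨ +-congʳ (+-congʳ (*-congˡ (oo-series-relation s sb x xb xsb≈s sxb≈sb k))) ⟩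
    x * (sb * B + s * Tₖ) + sb * (xb * B) + sb * B
      ≈⟨ solve 6 (λ s sb x xb B T → x :* (sb :* B :+ s :* T) :+ sb :* (xb :* B) :+ sb :* B := (x :* sb) :* B :+ sb :* B :+ s :* (x :* T) :+ sb :* (xb :* B)) refl s sb x xb B Tₖ ⟩
    (x * sb) * B + sb * B + s * (x * Tₖ) + sb * (xb * B) ≈⟨ +-congʳ (+-congʳ (+-cong (*-congʳ xsb≈s) (*-congʳ (sym sxb≈sb)))) ⟩
    s * B + (s * xb) * B + s * (x * Tₖ) + sb * (xb * B)
      ≈⟨ solve 6 (λ s sb x xb B T → s :* B :+ (s :* xb) :* B :+ s :* (x :* T) :+ sb :* (xb :* B) := sb :* (xb :* B) :+ s :* (xb :* B :+ B :+ x :* T)) refl s sb x xb B Tₖ ⟩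
    sb * (xb * B) + s * (xb * B + B + x * Tₖ)            ≈⟨ +-congˡ (*-congˡ (oo-series-suc x xb k)) ⟨
    sb * (xb * B) + s * T (suc k)                        ∎
    where
    T = lin 1# ⊛ (geom x ⊛ geom xb)
    X = x ^ k
    B = xb ^ k
    Tₖ = T k

  oo-entry : ∀ m s sb x xb a → x * xb ≈ 1# → s * s ≈ x → s * sb ≈ 1# →
    s * fpow x a m - sb * fpow xb a m ≈ (s - sb) * hoo m x xb a
  oo-entry m s sb x xb a xxb≈1 ss≈x ssb≈1 =
    fpow-difference s sb x xb _ a m (oo-series-relation s sb x xb xsb≈s sxb≈sb)
    where
    xsb≈s : x * sb ≈ s
    xsb≈s = begin
      x * sb        ≈⟨ *-congʳ ss≈x ⟨
      (s * s) * sb  ≈⟨ *-assoc s s sb ⟩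
      s * (s * sb)  ≈⟨ *-congˡ ssb≈1 ⟩
      s * 1#        ≈⟨ *-identityʳ s ⟩
      s             ∎
    sxb≈sb : s * xb ≈ sb
    sxb≈sb = begin
      s * xb                 ≈⟨ *-identityˡ _ ⟨
      1# * (s * xb)          ≈⟨ *-congʳ ssb≈1 ⟨
      (s * sb) * (s * xb)    ≈⟨ solve 3 (λ s sb xb → (s :* sb) :* (s :* xb) := sb :* ((s :* s) :* xb)) refl s sb xb ⟩
      sb * ((s * s) * xb)    ≈⟨ *-congˡ (*-congʳ ss≈x) ⟩
      sb * (x * xb)          ≈⟨ *-congˡ xxb≈1 ⟩
      sb * 1#                ≈⟨ *-identityʳ sb ⟩
      sb                     ∎

  -- eta half m is 1/2 at m = 0 and 1 otherwise; at m = 0 both sides equal 1.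
  heo-entry : ∀ half → half * (1# + 1#) ≈ 1# → ∀ m y yb a →
    heo m y yb a ≈ (fpow y a m + fpow yb a m) * eta half m
  heo-entry half 2half≈1 zero y yb a = begin
    ((1# + 1#) - 1#) * 1#  ≈⟨ *-identityʳ _ ⟩
    (1# + 1#) - 1#         ≈⟨ xyx⁻¹≈y 1# 1# ⟩
    1#                     ≈⟨ 2half≈1 ⟨
    half * (1# + 1#)       ≈⟨ *-comm _ _ ⟩
    (1# + 1#) * half       ∎
  heo-entry half _ (suc m) y yb a = begin
    heo (suc m) y yb a
      ≈⟨ ⊛-congˡ (prodLin a (suc m)) (suc m) (λ k → trans (+-congˡ -0#≈0#) (+-identityʳ _)) ⟩
    ((geom y ⊕ geom yb) ⊛ prodLin a (suc m)) (suc m)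
      ≈⟨ ⊛-distribʳ-⊕ (geom y) (geom yb) (prodLin a (suc m)) (suc m) ⟩
    hgl (suc m) y a + hgl (suc m) yb a            ≈⟨ +-cong (hgl≈fpow (suc m) y a) (hgl≈fpow (suc m) yb a) ⟩
    fpow y a (suc m) + fpow yb a (suc m)          ≈⟨ *-identityʳ _ ⟨
    (fpow y a (suc m) + fpow yb a (suc m)) * 1#   ∎

  sumFin-cong : ∀ n {f g : Fin n → Carrier} → (∀ i → f i ≈ g i) → sumFin n f ≈ sumFin n g
  sumFin-cong zero    f≈g = refl
  sumFin-cong (suc n) f≈g = +-cong (f≈g zero) (sumFin-cong n (λ i → f≈g (suc i)))

  sumFin-*ˡ : ∀ n u (f : Fin n → Carrier) → sumFin n (λ i → u * f i) ≈ u * sumFin n f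
  sumFin-*ˡ zero    u f = sym (zeroʳ u)
  sumFin-*ˡ (suc n) u f = trans (+-congˡ (sumFin-*ˡ n u (λ i → f (suc i)))) (sym (distribˡ u _ _))

  prodFin : (n : ℕ) → (Fin n → Carrier) → Carrier
  prodFin zero    r = 1#
  prodFin (suc n) r = r zero * prodFin n (λ i → r (suc i))

  prodFin-punchIn : ∀ n (r : Fin (suc n) → Carrier) i → r i * prodFin n (λ s → r (punchIn i s)) ≈ prodFin (suc n) r
  prodFin-punchIn n       r zero    = refl
  prodFin-punchIn (suc n) r (suc i) = begin
    r (suc i) * (r zero * prodFin n (λ s → r (suc (punchIn i s))))
      ≈⟨ solve 3 (λ a b c → a :* (b :* c) := b :* (a :* c)) refl (r (suc i)) (r zero) _ ⟩
    r zero * (r (suc i) * prodFin n (λ s → r (suc (punchIn i s))))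
      ≈⟨ *-congˡ (prodFin-punchIn n (λ s → r (suc s)) i) ⟩
    r zero * prodFin (suc n) (λ s → r (suc s)) ∎

  Minor : ∀ n → Matrix (suc n) → Fin (suc n) → Matrix n
  Minor n M i r s = M (punchIn i r) (suc s)

  Laplace-term : ∀ n → Matrix (suc n) → Fin (suc n) → Carrier
  Laplace-term n M i = sign (toℕ i) * (M i zero * det n (Minor n M i))

  det-cong : ∀ n {M N : Matrix n} → (∀ i j → M i j ≈ N i j) → det n M ≈ det n N
  det-cong zero    M≈N = refl
  det-cong (suc n) {M} {N} M≈N = sumFin-cong (suc n) term
    where
    term : ∀ i → Laplace-term n M i ≈ Laplace-term n N i
    term i = *-congˡ (*-cong (M≈N i zero) (det-cong n (λ r s → M≈N (punchIn i r) (suc s))))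

  det-scale-rows : ∀ n (r : Fin n → Carrier) (M : Matrix n) → det n (λ i j → r i * M i j) ≈ prodFin n r * det n M
  det-scale-rows zero    r M = sym (*-identityʳ _)
  det-scale-rows (suc n) r M = trans (sumFin-cong (suc n) term) (sumFin-*ˡ (suc n) _ (Laplace-term n M))
    where
    term : ∀ i → sign (toℕ i) * ((r i * M i zero) * det n (λ a b → r (punchIn i a) * Minor n M i a b))
               ≈ prodFin (suc n) r * Laplace-term n M i
    term i = begin
      sign (toℕ i) * ((r i * M i zero) * det n (λ a b → r (punchIn i a) * Minor n M i a b))
        ≈⟨ *-congˡ (*-congˡ (det-scale-rows n (λ a → r (punchIn i a)) (Minor n M i))) ⟩
      sign (toℕ i) * ((r i * M i zero) * (prodFin n (λ a → r (punchIn i a)) * det n (Minor n M i)))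
        ≈⟨ solve 5 (λ σ rᵢ m p d → σ :* ((rᵢ :* m) :* (p :* d)) := (rᵢ :* p) :* (σ :* (m :* d))) refl (sign (toℕ i)) (r i) (M i zero) _ _ ⟩
      (r i * prodFin n (λ a → r (punchIn i a))) * (sign (toℕ i) * (M i zero * det n (Minor n M i)))
        ≈⟨ *-congʳ (prodFin-punchIn n r i) ⟩
      prodFin (suc n) r * (sign (toℕ i) * (M i zero * det n (Minor n M i))) ∎

  det-scale-cols : ∀ n (v : Fin n → Carrier) (M : Matrix n) → det n (λ i j → M i j * v j) ≈ prodFin n v * det n M
  det-scale-cols zero    v M = sym (*-identityʳ _)
  det-scale-cols (suc n) v M = trans (sumFin-cong (suc n) term) (sumFin-*ˡ (suc n) _ (Laplace-term n M))
    where
    term : ∀ i → sign (toℕ i) * ((M i zero * v zero) * det n (λ a b → Minor n M i a b * v (suc b)))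
               ≈ prodFin (suc n) v * Laplace-term n M i
    term i = begin
      sign (toℕ i) * ((M i zero * v zero) * det n (λ a b → Minor n M i a b * v (suc b)))
        ≈⟨ *-congˡ (*-congˡ (det-scale-cols n (λ b → v (suc b)) (Minor n M i))) ⟩
      sign (toℕ i) * ((M i zero * v zero) * (prodFin n (λ b → v (suc b)) * det n (Minor n M i)))
        ≈⟨ solve 5 (λ σ m v₀ p d → σ :* ((m :* v₀) :* (p :* d)) := (v₀ :* p) :* (σ :* (m :* d))) refl (sign (toℕ i)) (M i zero) (v zero) _ _ ⟩
      prodFin (suc n) v * (sign (toℕ i) * (M i zero * det n (Minor n M i))) ∎

  prodFin-eta-expo : ∀ half k (lam : Fin (suc k) → ℕ) →
    prodFin (suc k) (λ j → eta half (expo (suc k) lam j)) ≈ eta half (lam (fromℕ k))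
  prodFin-eta-expo half zero    lam =
    trans (*-identityʳ _) (reflexive (≡.cong (eta half) (ℕ.+-identityʳ (lam zero))))
  prodFin-eta-expo half (suc k) lam =
    trans (*-cong (reflexive (≡.cong (eta half) (ℕ.+-suc (lam zero) k)))
                  (prodFin-eta-expo half k (λ i → lam (suc i))))
          (*-identityˡ _)

  gl-ratio : ∀ n (e e′ : Fin n → ℕ) a x →
    glDet n e x a * hglDet n e′ x a ≈ glDet n e′ x a * hglDet n e x a
  gl-ratio n e e′ a x = begin
    glDet n e x a * hglDet n e′ x a  ≈⟨ *-congˡ (hglDet≈glDet e′) ⟩
    glDet n e x a * glDet n e′ x a   ≈⟨ *-comm _ _ ⟩
    glDet n e′ x a * glDet n e x a   ≈⟨ *-congˡ (hglDet≈glDet e) ⟨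
    glDet n e′ x a * hglDet n e x a  ∎
    where
    hglDet≈glDet : ∀ e → hglDet n e x a ≈ glDet n e x a
    hglDet≈glDet e = det-cong n (λ i j → hgl≈fpow (e j) (x i) a)

  sp-ratio : ∀ n (e e′ : Fin n → ℕ) a x xb →
    spDet n e x xb a * hspDet n e′ x xb a ≈ spDet n e′ x xb a * hspDet n e x xb a
  sp-ratio n e e′ a x xb = cross-multiply _ (spDet≈ e) (spDet≈ e′)
    where
    spDet≈ : ∀ e → spDet n e x xb a ≈ prodFin n (λ i → x i - xb i) * hspDet n e x xb a
    spDet≈ e = trans (det-cong n (λ i j → sp-entry (e j) (x i) (xb i) a))
                     (det-scale-rows n (λ i → x i - xb i) (λ i j → hsp (e j) (x i) (xb i) a))

  so-ratio : ∀ n (e e′ : Fin n → ℕ) a x xb sx sxb →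
    (∀ i → x i * xb i ≈ 1#) → (∀ i → sx i * sx i ≈ x i) → (∀ i → sx i * sxb i ≈ 1#) →
    soDet n e x xb sx sxb a * hooDet n e′ x xb a ≈ soDet n e′ x xb sx sxb a * hooDet n e x xb a
  so-ratio n e e′ a x xb sx sxb xxb≈1 sxsx≈x sxsxb≈1 = cross-multiply _ (soDet≈ e) (soDet≈ e′)
    where
    soDet≈ : ∀ e → soDet n e x xb sx sxb a ≈ prodFin n (λ i → sx i - sxb i) * hooDet n e x xb a
    soDet≈ e = trans (det-cong n (λ i j → oo-entry (e j) (sx i) (sxb i) (x i) (xb i) a (xxb≈1 i) (sxsx≈x i) (sxsxb≈1 i)))
                     (det-scale-rows n (λ i → sx i - sxb i) (λ i j → hoo (e j) (x i) (xb i) a))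

  o-ratio : ∀ half → half * (1# + 1#) ≈ 1# → ∀ n (e e′ : Fin n → ℕ) {η η′} →
    prodFin n (λ j → eta half (e j)) ≈ η → prodFin n (λ j → eta half (e′ j)) ≈ η′ → ∀ a x xb →
    (η * oDet n e x xb a) * heoDet n e′ x xb a ≈ (η′ * oDet n e′ x xb a) * heoDet n e x xb a
  o-ratio half 2half≈1 n e e′ {η} {η′} ∏e≈η ∏e′≈η′ a x xb = begin
    (η * oDet n e x xb a) * heoDet n e′ x xb a         ≈⟨ *-congˡ (heoDet≈ e′ ∏e′≈η′) ⟩
    (η * oDet n e x xb a) * (η′ * oDet n e′ x xb a)    ≈⟨ *-comm _ _ ⟩
    (η′ * oDet n e′ x xb a) * (η * oDet n e x xb a)    ≈⟨ *-congˡ (heoDet≈ e ∏e≈η) ⟨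
    (η′ * oDet n e′ x xb a) * heoDet n e x xb a        ∎
    where
    heoDet≈ : ∀ e {η} → prodFin n (λ j → eta half (e j)) ≈ η → heoDet n e x xb a ≈ η * oDet n e x xb a
    heoDet≈ e ∏≈η = begin
      heoDet n e x xb a
        ≈⟨ det-cong n (λ i j → heo-entry half 2half≈1 (e j) (x i) (xb i) a) ⟩
      det n (λ i j → (fpow (x i) a (e j) + fpow (xb i) a (e j)) * eta half (e j))
        ≈⟨ det-scale-cols n (λ j → eta half (e j)) (λ i j → fpow (x i) a (e j) + fpow (xb i) a (e j)) ⟩
      prodFin n (λ j → eta half (e j)) * oDet n e x xb a
        ≈⟨ *-congʳ ∏≈η ⟩
      _ * oDet n e x xb a ∎

lemma1 : ∀ {c ℓ : Level} (R : CommutativeRing c ℓ) → let open CommutativeRing R in let open Char R in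
    ∀ (k : ℕ) (lam : Fin (suc k) → ℕ) → IsPartition (suc k) lam → (a : ℕ → Carrier) →
    ((x : Fin (suc k) → Carrier) →
      glDet (suc k) (expo (suc k) lam) x a * hglDet (suc k) (expo0 (suc k)) x a
        ≈ glDet (suc k) (expo0 (suc k)) x a * hglDet (suc k) (expo (suc k) lam) x a)
    × ((x xb : Fin (suc k) → Carrier) → (∀ i → x i * xb i ≈ 1#) →
      spDet (suc k) (expo (suc k) lam) x xb a * hspDet (suc k) (expo0 (suc k)) x xb a
        ≈ spDet (suc k) (expo0 (suc k)) x xb a * hspDet (suc k) (expo (suc k) lam) x xb a)
    × ((x xb sx sxb : Fin (suc k) → Carrier) → (∀ i → x i * xb i ≈ 1#) →
      (∀ i → sx i * sx i ≈ x i) → (∀ i → sx i * sxb i ≈ 1#) →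
      soDet (suc k) (expo (suc k) lam) x xb sx sxb a * hooDet (suc k) (expo0 (suc k)) x xb a
        ≈ soDet (suc k) (expo0 (suc k)) x xb sx sxb a * hooDet (suc k) (expo (suc k) lam) x xb a)
    × ((half : Carrier) → half * (1# + 1#) ≈ 1# →
      (x xb : Fin (suc k) → Carrier) → (∀ i → x i * xb i ≈ 1#) →
      (eta half (lam (fromℕ k)) * oDet (suc k) (expo (suc k) lam) x xb a) * heoDet (suc k) (expo0 (suc k)) x xb a
        ≈ (half * oDet (suc k) (expo0 (suc k)) x xb a) * heoDet (suc k) (expo (suc k) lam) x xb a)
lemma1 R k lam _ a =
    gl-ratio R n e e₀ a
  , (λ x xb _ → sp-ratio R n e e₀ a x xb)
  , so-ratio R n e e₀ a
  , λ half 2half≈1 x xb _ →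
      o-ratio R half 2half≈1 n e e₀ (prodFin-eta-expo R half k lam) (prodFin-eta-expo R half k (λ _ → 0)) a x xb
  where
  open Char R using (expo; expo0)
  n = suc k
  e = expo n lam
  e₀ = expo0 n
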